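{- Let $k$ be a positive integer and let $G$ be a forest on $n$ vertices, of which $m$ are isolated. Then $$\alpha_k(G)\geq Z_{k+1}(G)=\frac{(n-m)(k+1)}{k+2}+m.$$
   Context: A $k$-independent set of $G$ is a set $S\subseteq V(G)$ with $\Delta(G[S])\leq k$; $\alpha_k(G)$ is the maximum cardinality of a $k$-independent set. For a vertex $v$, $\zeta(v)=\max_H\delta(H)$ over all subgraphs $H$ of $G$ containing $v$ ($\delta$ = minimum degree), and for a positive integer $r$, $Z_r(G)=\sum_{v\in V(G)}\min\{1,\frac{1}{\zeta(v)+1/r}\}$. -}

module Defs where

open import Data.Bool using (Bool; true; false; _∧_; not; if_then_else_)
open import Data.Nat as ℕ using (ℕ; zero; suc; _≤_; _≤ᵇ_; _⊔_; _∸_; _⊓_)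
open import Data.Fin using (Fin; zero; suc; fromℕ; inject₁)
open import Data.Fin.Subset using (Subset; _∈_; ∣_∣)
open import Data.Vec using (Vec; []; _∷_; lookup)
open import Data.List using (List; []; _∷_; [_]; map; _++_; foldr; filterᵇ; allFin; length)
open import Data.Product using (Σ; ∃; _×_; _,_)
open import Data.Empty using (⊥)
open import Relation.Binary.PropositionalEquality using (_≡_)
open import Function.Definitions using (Injective)
open import Data.Integer using (+_)
open import Data.Rational as ℚ using (ℚ; _/_; 1/_; Positive; NonZero)
open import Data.Rational.Properties as ℚP using (normalize-nonNeg; normalize-pos; nonNeg+pos⇒pos; pos⇒nonZero)

record Graph (n : ℕ) : Set where
  field
    adj   : Fin n → Fin n → Bool
    sym   : ∀ u v → adj u v ≡ adj v u
    irrefl : ∀ v → adj v v ≡ false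
open Graph public

count : ∀ {n} → (Fin n → Bool) → ℕ
count {n} p = length (filterᵇ p (allFin n))

deg : ∀ {n} → Graph n → Fin n → ℕ
deg G v = count (adj G v)

Isolated : ∀ {n} → Graph n → Fin n → Set
Isolated G v = deg G v ≡ 0

numIsolated : ∀ {n} → Graph n → ℕ
numIsolated G = count (λ v → deg G v ℕ.≡ᵇ 0)

-- Forests: simple graphs without cycles.
-- A cycle of length l = j+3 ≥ 3 is an injective map f : Fin l → Fin n
-- with f i ~ f (i+1) for all i < l-1 and f (l-1) ~ f 0.

record Cycle {n : ℕ} (G : Graph n) : Set where
  field
    j      : ℕ
    f      : Fin (suc (suc (suc j))) → Fin n
    inj    : Injective _≡_ _≡_ f
    step   : ∀ (i : Fin (suc (suc j))) → adj G (f (inject₁ i)) (f (suc i)) ≡ true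
    close  : adj G (f (fromℕ (suc (suc j)))) (f zero) ≡ true

IsForest : ∀ {n} → Graph n → Set
IsForest G = Cycle G → ⊥

degIn : ∀ {n} → Graph n → Subset n → Fin n → ℕ
degIn G S v = count (λ u → lookup S u ∧ adj G v u)

KIndependent : ∀ {n} → ℕ → Graph n → Subset n → Set
KIndependent k G S = ∀ v → v ∈ S → degIn G S v ≤ k

kIndepᵇ : ∀ {n} → ℕ → Graph n → Subset n → Bool
kIndepᵇ {n} k G S = foldr (λ v b → (not (lookup S v) ∨ (degIn G S v ≤ᵇ k)) ∧ b) true (allFin n)
  where open import Data.Bool using (_∨_)

subsets : ∀ n → List (Subset n)
subsets zero    = [ [] ]
subsets (suc n) = map (true ∷_) (subsets n) ++ map (false ∷_) (subsets n)

α : ∀ {n} → ℕ → Graph n → ℕ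
α {n} k G = foldr _⊔_ 0 (map ∣_∣ (filterᵇ (kIndepᵇ k G) (subsets n)))

record Subgraph {n : ℕ} (G : Graph n) : Set where
  field
    verts  : Subset n
    edges  : Fin n → Fin n → Bool
    esym   : ∀ u w → edges u w ≡ edges w u
    esub   : ∀ u w → edges u w ≡ true → adj G u w ≡ true
    everts : ∀ u w → edges u w ≡ true → u ∈ verts × w ∈ verts
open Subgraph public

degH : ∀ {n} {G : Graph n} → Subgraph G → Fin n → ℕ
degH H u = count (edges H u)

IsMinDeg : ∀ {n} {G : Graph n} → Subgraph G → ℕ → Set
IsMinDeg H d = (∃ λ u → u ∈ verts H × degH H u ≡ d) × (∀ u → u ∈ verts H → d ≤ degH H u)

IsZeta : ∀ {n} → Graph n → Fin n → ℕ → Set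
IsZeta G v z =
  (Σ (Subgraph G) λ H → v ∈ verts H × IsMinDeg H z) ×
  (∀ (H : Subgraph G) d → v ∈ verts H → IsMinDeg H d → d ≤ z)

ℕtoℚ : ℕ → ℚ
ℕtoℚ z = + z / 1

zeta+1/r-nonZero : ∀ z r .{{_ : ℕ.NonZero r}} → NonZero (ℕtoℚ z ℚ.+ (+ 1 / r))
zeta+1/r-nonZero z r =
  pos⇒nonZero (ℕtoℚ z ℚ.+ (+ 1 / r)) {{nonNeg+pos⇒pos (ℕtoℚ z) {{normalize-nonNeg z 1}} (+ 1 / r) {{normalize-pos 1 r}}}}

term : (r : ℕ) .{{_ : ℕ.NonZero r}} → ℕ → ℚ
term r z = ℚ.1ℚ ℚ.⊓ (1/ (ℕtoℚ z ℚ.+ (+ 1 / r))) {{zeta+1/r-nonZero z r}}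

sumℚ : ∀ {n} → (Fin n → ℚ) → ℚ
sumℚ {n} f = foldr (λ v acc → f v ℚ.+ acc) ℚ.0ℚ (allFin n)

Z : ∀ {n} (r : ℕ) .{{_ : ℕ.NonZero r}} → (Fin n → ℕ) → ℚ
Z r ζ = sumℚ (λ v → term r (ζ v))

-- In a forest no subgraph has minimum degree 2, since such a subgraph contains a cycle; hence
-- ζ(v) is 0 for isolated vertices and 1 otherwise, and Z_{k+1}(G) = m + (n − m)(k+1)/(k+2).
-- For the bound on α_k we peel off vertices of degree at most 1 while building a k-independent
-- set S with (k+2)|S| ≥ (k+1)n + m.  Vertices carry weights, initially 1: a leaf u whose
-- neighbour p satisfies w(u) + w(p) ≤ k + 1 is merged into p, and otherwise p is discarded,
-- its exclusion paid for by the weight w(u) + w(p) ≥ k + 2 that leaves the forest; in both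
-- cases, as for an isolated vertex, u itself joins S.

module Submission where

open import Data.Bool using (Bool; true; false; _∧_; _∨_; not; if_then_else_)
open import Data.Bool.Properties using (∧-zeroʳ; ∧-identityʳ; ∨-zeroʳ; ¬-not; T-≡) renaming (_≟_ to _≟ᵇ_)
open import Function.Bundles using (Equivalence)
open import Data.Integer as ℤ using (+[1+_])
import Data.Integer.Properties as ℤ
open import Data.Integer.Properties using (pos-*; pos-+)
open import Data.Rational as ℚ using (ℚ; toℚᵘ)
import Data.Rational.Properties as ℚP
open import Data.Rational.Properties using (toℚᵘ-homo-+; toℚᵘ-homo-1/; toℚᵘ-fromℚᵘ; toℚᵘ-cancel-≤; toℚᵘ-injective)
open import Data.Rational.Unnormalised as ℚᵘ using (ℚᵘ; mkℚᵘ; _≃_; *≡*; *≤*) renaming (_+_ to _+ᵘ_; _≤_ to _≤ᵘ_)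
import Data.Rational.Unnormalised.Properties as ℚᵘP
open import Data.Rational.Unnormalised.Properties using (≃-reflexive; ≃-trans; module ≃-Reasoning)
open import Data.Nat using (ℕ; zero; suc; _+_; _*_; _≤_; _<_; z≤n; s≤s; _∸_; _≤?_; _≡ᵇ_; _≤ᵇ_; _⊔_; NonZero)
open import Data.Nat.Properties
open import Relation.Binary.Definitions using (tri<; tri≈; tri>)
open import Data.Nat.Tactic.RingSolver using (solve-∀)
open import Data.Fin using (Fin; zero; suc; toℕ; fromℕ<; inject₁; fromℕ)
open import Data.Fin.Properties using (any?; pigeonhole; ¬∀⟶∃¬-smallest; toℕ-inject; toℕ-fromℕ<; toℕ-inject₁; toℕ-fromℕ; toℕ-injective; toℕ<n) renaming (suc-injective to Fin-suc-injective; _≟_ to _≟ᶠ_)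
open import Data.List using (List; []; _∷_; length; filterᵇ; tabulate; map; foldr; allFin)
open import Data.List.Membership.Propositional using (_∈_)
open import Data.List.Membership.Propositional.Properties using (∈-map⁺; ∈-++⁺ˡ; ∈-++⁺ʳ; ∈-filter⁺)
open import Data.List.Relation.Unary.Any using (here; there)
open import Data.Fin.Subset using (∣_∣) renaming (_∈_ to _∈ₛ_)
open import Data.Product using (∃-syntax; _×_; _,_; proj₁; proj₂)
open import Data.Vec.Functional using (updateAt)
open import Data.Vec.Functional.Properties using (updateAt-updates; updateAt-minimal)
open import Function using (_∘_; const; id)
open import Relation.Nullary using (¬_; ¬?; Dec; yes; no; contradiction)
open import Relation.Nullary.Decidable using (decidable-stable; _×-dec_; does; dec-true; dec-false; T?)
import Data.Vec as Vec
open import Data.Vec using (_∷_)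
open import Data.Vec.Properties using (lookup∘tabulate; lookup⇒[]=; []=⇒lookup)
open import Data.Sum using (_⊎_; inj₁; inj₂)
open import Relation.Binary.PropositionalEquality
open import Defs using (count; Graph; adj; irrefl; Cycle; IsForest; deg; Isolated; numIsolated; degIn; kIndepᵇ; subsets; α; ℕtoℚ; term; sumℚ; zeta+1/r-nonZero; Z; Subgraph; verts; edges; esub; degH; IsMinDeg; IsZeta)

∑ : ∀ {n} → (Fin n → ℕ) → ℕ
∑ {zero}  f = 0
∑ {suc n} f = f zero + ∑ (f ∘ suc)

∑-cong : ∀ {n} {f g : Fin n → ℕ} → (∀ v → f v ≡ g v) → ∑ f ≡ ∑ g
∑-cong {zero}  f≗g = refl
∑-cong {suc n} f≗g = cong₂ _+_ (f≗g zero) (∑-cong (f≗g ∘ suc))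

∑-mono-≤ : ∀ {n} {f g : Fin n → ℕ} → (∀ v → f v ≤ g v) → ∑ f ≤ ∑ g
∑-mono-≤ {zero}  f≤g = z≤n
∑-mono-≤ {suc n} f≤g = +-mono-≤ (f≤g zero) (∑-mono-≤ (f≤g ∘ suc))

∑-const : ∀ n c → ∑ {n} (const c) ≡ n * c
∑-const zero    c = refl
∑-const (suc n) c = cong (c +_) (∑-const n c)

∑-distrib-+ : ∀ {n} (f g : Fin n → ℕ) → ∑ (λ v → f v + g v) ≡ ∑ f + ∑ g
∑-distrib-+ {zero}  f g = refl
∑-distrib-+ {suc n} f g = begin
  f zero + g zero + ∑ (λ v → f (suc v) + g (suc v)) ≡⟨ cong (f zero + g zero +_) (∑-distrib-+ (f ∘ suc) (g ∘ suc)) ⟩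
  f zero + g zero + (∑ (f ∘ suc) + ∑ (g ∘ suc))     ≡⟨ +-+-comm (f zero) (g zero) _ _ ⟩
  f zero + ∑ (f ∘ suc) + (g zero + ∑ (g ∘ suc))     ∎
  where
  open ≡-Reasoning
  +-+-comm : ∀ a b c d → a + b + (c + d) ≡ a + c + (b + d)
  +-+-comm = solve-∀

term≤∑ : ∀ {n} (f : Fin n → ℕ) v → f v ≤ ∑ f
term≤∑ f zero    = m≤m+n _ _
term≤∑ f (suc v) = ≤-trans (term≤∑ (f ∘ suc) v) (m≤n+m _ _)

∑-agree-except : ∀ {n} (f g : Fin n → ℕ) x → (∀ v → v ≢ x → f v ≡ g v) → ∑ f + g x ≡ ∑ g + f x
∑-agree-except {suc n} f g zero f≗g
  rewrite ∑-cong {f = f ∘ suc} {g = g ∘ suc} (λ v → f≗g (suc v) λ ()) = swap (f zero) (g zero) (∑ (g ∘ suc))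
  where
  swap : ∀ a b c → a + c + b ≡ b + c + a
  swap = solve-∀
∑-agree-except {suc n} f g (suc x) f≗g rewrite f≗g zero (λ ()) = begin
  g zero + ∑ (f ∘ suc) + g (suc x)   ≡⟨ +-assoc (g zero) _ _ ⟩
  g zero + (∑ (f ∘ suc) + g (suc x)) ≡⟨ cong (g zero +_) (∑-agree-except (f ∘ suc) (g ∘ suc) x λ v v≢x → f≗g (suc v) (v≢x ∘ Fin-suc-injective)) ⟩
  g zero + (∑ (g ∘ suc) + f (suc x)) ≡⟨ +-assoc (g zero) _ _ ⟨
  g zero + ∑ (g ∘ suc) + f (suc x)   ∎
  where open ≡-Reasoning

∧-true⁻ : ∀ {a b} → a ∧ b ≡ true → a ≡ true × b ≡ true
∧-true⁻ {true} {true} _ = refl , refl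

≡ᵇ0⇒≡0 : ∀ m → (m ≡ᵇ 0) ≡ true → m ≡ 0
≡ᵇ0⇒≡0 zero _ = refl

VSet : ℕ → Set
VSet n = Fin n → Bool

module _ {n : ℕ} where

  infix 4 _⊆_
  _⊆_ : VSet n → VSet n → Set
  B ⊆ A = ∀ {v} → B v ≡ true → A v ≡ true

  _∖_ : VSet n → VSet n → VSet n
  (A ∖ S) v = A v ∧ not (S v)

  remove : Fin n → VSet n → VSet n
  remove u A = updateAt A u (const false)

  insert : Fin n → VSet n → VSet n
  insert u S = updateAt S u (const true)

  remove-self : ∀ u (A : VSet n) → remove u A u ≡ false
  remove-self u A = updateAt-updates u A

  remove-other : ∀ {u v} (A : VSet n) → v ≢ u → remove u A v ≡ A v
  remove-other A v≢u = updateAt-minimal _ _ A v≢u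

  insert-self : ∀ u (S : VSet n) → insert u S u ≡ true
  insert-self u S = updateAt-updates u S

  insert-other : ∀ {u v} (S : VSet n) → v ≢ u → insert u S v ≡ S v
  insert-other S v≢u = updateAt-minimal _ _ S v≢u

  remove-∈ : ∀ {u v} (A : VSet n) → v ≢ u → A v ≡ true → remove u A v ≡ true
  remove-∈ A v≢u Av = trans (remove-other A v≢u) Av

  remove-∈⁻ : ∀ {u v} (A : VSet n) → remove u A v ≡ true → v ≢ u × A v ≡ true
  remove-∈⁻ {u} {v} A Av with v ≟ᶠ u
  ... | yes refl = contradiction (trans (sym Av) (remove-self u A)) λ ()
  ... | no  v≢u  = v≢u , trans (sym (remove-other A v≢u)) Av

  remove-⊆ : ∀ u (A : VSet n) → remove u A ⊆ A
  remove-⊆ u A Av = proj₂ (remove-∈⁻ A Av)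

  ⊆-remove⇒∉ : ∀ {S A : VSet n} {u} → S ⊆ remove u A → S u ≡ false
  ⊆-remove⇒∉ {S} {A} {u} S⊆A-u with S u in Su
  ... | false = refl
  ... | true  = contradiction (trans (sym (S⊆A-u Su)) (remove-self u A)) λ ()

  insert-⊆ : ∀ {S A : VSet n} {u} → A u ≡ true → S ⊆ remove u A → insert u S ⊆ A
  insert-⊆ {S} {A} {u} Au S⊆A-u {v} Sv with v ≟ᶠ u
  ... | yes refl = Au
  ... | no  v≢u  = remove-⊆ u A (S⊆A-u (trans (sym (insert-other S v≢u)) Sv))

  ∑[_]_ : VSet n → (Fin n → ℕ) → ℕ
  ∑[ A ] w = ∑ λ v → if A v then w v else 0

  size : VSet n → ℕ
  size A = ∑[ A ] const 1

  ∑[]-mono-≤ : ∀ {A B : VSet n} {w w′ : Fin n → ℕ} →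
               (∀ {v} → A v ≡ true → B v ≡ true × w v ≤ w′ v) → ∑[ A ] w ≤ ∑[ B ] w′
  ∑[]-mono-≤ {A} {B} {w} {w′} A⇒B = ∑-mono-≤ pointwise
    where
    pointwise : ∀ v → (if A v then w v else 0) ≤ (if B v then w′ v else 0)
    pointwise v with A v in Av
    ... | false = z≤n
    ... | true with A⇒B Av
    ...   | Bv , w≤w′ rewrite Bv = w≤w′

  ∑[]-remove : ∀ (A : VSet n) w u → ∑[ A ] w ≡ ∑[ remove u A ] w + (if A u then w u else 0)
  ∑[]-remove A w u = begin
    ∑[ A ] w                                               ≡⟨ +-identityʳ _ ⟨
    ∑[ A ] w + 0                                           ≡⟨ cong (λ b → ∑[ A ] w + (if b then w u else 0)) (remove-self u A) ⟨
    ∑[ A ] w + (if remove u A u then w u else 0)           ≡⟨ ∑-agree-except _ _ u agree ⟩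
    ∑[ remove u A ] w + (if A u then w u else 0)           ∎
    where
    open ≡-Reasoning
    agree : ∀ v → v ≢ u → (if A v then w v else 0) ≡ (if remove u A v then w v else 0)
    agree v v≢u = cong (λ b → if b then w v else 0) (sym (remove-other A v≢u))

  ∑[]-remove-∈ : ∀ {A : VSet n} w {u} → A u ≡ true → ∑[ A ] w ≡ ∑[ remove u A ] w + w u
  ∑[]-remove-∈ {A} w {u} Au = trans (∑[]-remove A w u) (cong (λ b → ∑[ remove u A ] w + (if b then w u else 0)) Au)

  ∑[]-updateAt : ∀ {A : VSet n} w {p} (f : ℕ → ℕ) → A p ≡ true →
                 ∑[ A ] updateAt w p f + w p ≡ ∑[ A ] w + f (w p)
  ∑[]-updateAt {A} w {p} f Ap = begin
    ∑[ A ] w′ + w p                         ≡⟨ cong (λ b → ∑[ A ] w′ + (if b then w p else 0)) Ap ⟨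
    ∑[ A ] w′ + (if A p then w p else 0)    ≡⟨ ∑-agree-except _ _ p agree ⟩
    ∑[ A ] w + (if A p then w′ p else 0)    ≡⟨ cong (λ b → ∑[ A ] w + (if b then w′ p else 0)) Ap ⟩
    ∑[ A ] w + w′ p                         ≡⟨ cong (∑[ A ] w +_) (updateAt-updates p w) ⟩
    ∑[ A ] w + f (w p)                      ∎
    where
    open ≡-Reasoning
    w′ = updateAt w p f
    agree : ∀ v → v ≢ p → (if A v then w′ v else 0) ≡ (if A v then w v else 0)
    agree v v≢p = cong (if A v then_else 0) (updateAt-minimal v p w v≢p)

  ∑[]-empty : ∀ {A : VSet n} w → (∀ v → A v ≡ false) → ∑[ A ] w ≡ 0
  ∑[]-empty {A} w A≡∅ = trans (∑-cong λ v → cong (if_then w v else 0) (A≡∅ v)) (trans (∑-const n 0) (*-zeroʳ n))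

  size-mono : ∀ {A B : VSet n} → A ⊆ B → size A ≤ size B
  size-mono A⊆B = ∑[]-mono-≤ λ Av → A⊆B Av , ≤-refl

  size-full : size (const true) ≡ n
  size-full = trans (∑-const n 1) (*-identityʳ n)

  size≤n : ∀ (A : VSet n) → size A ≤ n
  size≤n A = subst (size A ≤_) size-full (size-mono {B = const true} (const refl))

  size-∈ : ∀ {A : VSet n} {v} → A v ≡ true → 1 ≤ size A
  size-∈ {A} {v} Av = subst (λ b → (if b then 1 else 0) ≤ size A) Av (term≤∑ _ v)

  size≡0⇒∉ : ∀ {A : VSet n} → size A ≡ 0 → ∀ v → A v ≡ false
  size≡0⇒∉ {A} size≡0 v with A v in Av
  ... | false = refl
  ... | true  = contradiction (subst (1 ≤_) size≡0 (size-∈ Av)) λ ()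

  size>0⇒∈ : ∀ {A : VSet n} → 1 ≤ size A → ∃[ v ] A v ≡ true
  size>0⇒∈ {A} 1≤size with any? (λ v → A v ≟ᵇ true)
  ... | yes v∈A = v∈A
  ... | no  ∄   = contradiction (∑[]-empty (const 1) λ v → ¬-not λ Av → ∄ (v , Av)) (>⇒≢ 1≤size)

  size-cong : ∀ {A B : VSet n} → (∀ v → A v ≡ B v) → size A ≡ size B
  size-cong A≗B = ∑-cong λ v → cong (if_then 1 else 0) (A≗B v)

  remove-∖ : ∀ (A S : VSet n) u v → remove u (A ∖ S) v ≡ (remove u A ∖ S) v
  remove-∖ A S u v with v ≟ᶠ u
  ... | yes refl rewrite remove-self v (A ∖ S) | remove-self v A = refl
  ... | no  v≢u  rewrite remove-other (A ∖ S) v≢u | remove-other A v≢u = refl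

  size-∖-+ : ∀ {A S : VSet n} → S ⊆ A → size (A ∖ S) + size S ≡ size A
  size-∖-+ {A} {S} S⊆A = trans (sym (∑-distrib-+ (λ v → if A v ∧ not (S v) then 1 else 0) (λ v → if S v then 1 else 0))) (∑-cong pointwise)
    where
    pointwise : ∀ v → (if A v ∧ not (S v) then 1 else 0) + (if S v then 1 else 0) ≡ (if A v then 1 else 0)
    pointwise v with S v in Sv
    ... | true  rewrite S⊆A Sv = refl
    ... | false rewrite ∧-identityʳ (A v) = +-identityʳ _

  ∖-insert : ∀ (A S : VSet n) u → size (A ∖ insert u S) ≡ size (remove u A ∖ S)
  ∖-insert A S u = size-cong pointwise
    where
    pointwise : ∀ v → A v ∧ not (insert u S v) ≡ remove u A v ∧ not (S v)
    pointwise v with v ≟ᶠ u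
    ... | yes refl rewrite insert-self v S | remove-self v A = ∧-zeroʳ (A v)
    ... | no  v≢u  rewrite insert-other S v≢u | remove-other A v≢u = refl

  size-remove-∈ : ∀ {A : VSet n} {u} → A u ≡ true → size A ≡ suc (size (remove u A))
  size-remove-∈ {A} {u} Au = trans (∑[]-remove-∈ (const 1) Au) (+-comm _ 1)

  size-remove-≤ : ∀ (A : VSet n) u → size A ≤ suc (size (remove u A))
  size-remove-≤ A u = begin
    size A                                        ≡⟨ ∑[]-remove A (const 1) u ⟩
    size (remove u A) + (if A u then 1 else 0)    ≤⟨ +-monoʳ-≤ (size (remove u A)) (indicator≤1 (A u)) ⟩
    size (remove u A) + 1                         ≡⟨ +-comm _ 1 ⟩
    suc (size (remove u A))                       ∎
    where
    open ≤-Reasoning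
    indicator≤1 : ∀ b → (if b then 1 else 0) ≤ 1
    indicator≤1 true  = ≤-refl
    indicator≤1 false = z≤n

  size-remove-∈-≤ : ∀ {A : VSet n} {u N} → A u ≡ true → size A ≤ suc N → size (remove u A) ≤ N
  size-remove-∈-≤ {A} {u} {N} Au size≤ = ≤-pred (subst (_≤ suc N) (size-remove-∈ {A = A} Au) size≤)

  size>1⇒∈-other : ∀ {A : VSet n} x → 2 ≤ size A → ∃[ v ] v ≢ x × A v ≡ true
  size>1⇒∈-other {A} x 2≤size with size>0⇒∈ (≤-pred (≤-trans 2≤size (size-remove-≤ A x)))
  ... | v , v∈A-x = v , remove-∈⁻ A v∈A-x

  size-singleton : ∀ {A : VSet n} {y} → A y ≡ true → (∀ {x} → x ≢ y → A x ≡ false) → size A ≡ 1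
  size-singleton {A} {y} Ay only-y = trans (size-remove-∈ Ay) (cong suc (∑[]-empty (const 1) empty))
    where
    empty : ∀ x → remove y A x ≡ false
    empty x with x ≟ᶠ y
    ... | yes refl = remove-self x A
    ... | no  x≢y  = trans (remove-other A x≢y) (only-y x≢y)

  size≡1⇒unique : ∀ {A : VSet n} {y} → size A ≡ 1 → A y ≡ true → ∀ {x} → x ≢ y → A x ≡ false
  size≡1⇒unique {A} {y} size≡1 Ay {x} x≢y =
    trans (sym (remove-other A x≢y)) (size≡0⇒∉ (suc-injective (trans (sym (size-remove-∈ Ay)) size≡1)) x)

∈-tabulate : ∀ {n} (X : VSet n) {x} → X x ≡ true → x ∈ₛ Vec.tabulate X
∈-tabulate X {x} Xx = lookup⇒[]= x _ (trans (lookup∘tabulate X x) Xx)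

∈-tabulate⁻ : ∀ {n} (X : VSet n) {x} → x ∈ₛ Vec.tabulate X → X x ≡ true
∈-tabulate⁻ X {x} x∈X = trans (sym (lookup∘tabulate X x)) ([]=⇒lookup x∈X)

length-filterᵇ-tabulate : ∀ {A : Set} {n} (p : A → Bool) (f : Fin n → A) →
                          length (filterᵇ p (tabulate f)) ≡ size (p ∘ f)
length-filterᵇ-tabulate {n = zero}  p f = refl
length-filterᵇ-tabulate {n = suc n} p f with p (f zero)
... | true  = cong suc (length-filterᵇ-tabulate p (f ∘ suc))
... | false = length-filterᵇ-tabulate p (f ∘ suc)

count≡size : ∀ {n} (A : VSet n) → count A ≡ size A
count≡size A = length-filterᵇ-tabulate A id

module _ {n : ℕ} (G : Graph n) where

  neighboursIn : VSet n → Fin n → VSet n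
  neighboursIn A u x = A x ∧ adj G u x

  degOn : VSet n → Fin n → ℕ
  degOn A u = size (neighboursIn A u)

  degOn-mono : ∀ {A B : VSet n} → B ⊆ A → ∀ v → degOn B v ≤ degOn A v
  degOn-mono {A} {B} B⊆A v = size-mono {A = neighboursIn B v} {B = neighboursIn A v} λ Bx∧adj → let Bx , vx = ∧-true⁻ Bx∧adj in cong₂ _∧_ (B⊆A Bx) vx

  adj⇒≢ : ∀ {x y} → adj G x y ≡ true → x ≢ y
  adj⇒≢ {x} xy refl = contradiction (trans (sym xy) (irrefl G x)) λ ()

  degOn-insert-nonadj : ∀ {S : VSet n} {u x} → adj G x u ≡ false → degOn (insert u S) x ≡ degOn S x
  degOn-insert-nonadj {S} {u} {x} xu = size-cong pointwise
    where
    pointwise : ∀ y → insert u S y ∧ adj G x y ≡ S y ∧ adj G x y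
    pointwise y with y ≟ᶠ u
    ... | yes refl rewrite xu = trans (∧-zeroʳ _) (sym (∧-zeroʳ _))
    ... | no  y≢u  rewrite insert-other S y≢u = refl

  degOn-insert-adj : ∀ {S : VSet n} {u x} → S u ≡ false → adj G x u ≡ true → degOn (insert u S) x ≡ suc (degOn S x)
  degOn-insert-adj {S} {u} {x} Su xu = begin
    degOn (insert u S) x                                  ≡⟨ size-remove-∈ {A = neighboursIn (insert u S) x} (cong₂ _∧_ (insert-self u S) xu) ⟩
    suc (size (remove u (neighboursIn (insert u S) x)))   ≡⟨ cong suc (size-cong pointwise) ⟩
    suc (degOn S x)                                       ∎
    where
    open ≡-Reasoning
    pointwise : ∀ y → remove u (neighboursIn (insert u S) x) y ≡ S y ∧ adj G x y
    pointwise y with y ≟ᶠ u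
    ... | yes refl rewrite remove-self y (neighboursIn (insert u S) x) | Su = refl
    ... | no  y≢u  rewrite remove-other (neighboursIn (insert u S) x) y≢u | insert-other S y≢u = refl

  isolated⇒nonadj : ∀ {A : VSet n} {u x} → degOn A u ≡ 0 → A x ≡ true → adj G u x ≡ false
  isolated⇒nonadj {A} {u} {x} deg≡0 Ax = subst (λ b → b ∧ adj G u x ≡ false) Ax (size≡0⇒∉ deg≡0 x)

  leaf⇒nonadj : ∀ {A : VSet n} {u p x} → degOn A u ≡ 1 → neighboursIn A u p ≡ true →
                A x ≡ true → x ≢ p → adj G u x ≡ false
  leaf⇒nonadj {A} {u} {p} {x} deg≡1 up Ax x≢p = subst (λ b → b ∧ adj G u x ≡ false) Ax (size≡1⇒unique deg≡1 up x≢p)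

-- A walk inside A that never immediately returns along its last edge can always be
-- continued, and its first repeated vertex closes a cycle.
module NonBacktrackingWalk {n : ℕ} (G : Graph n) (A : VSet n)
  (deg≥2 : ∀ {u} → A u ≡ true → 2 ≤ degOn G A u) {u₀ : Fin n} (u₀∈A : A u₀ ≡ true) where

  record Position : Set where
    constructor ⟨_,_,_⟩
    field
      prev cur : Fin n
      cur∈A    : A cur ≡ true
  open Position

  forward : (s : Position) → ∃[ v ] v ≢ prev s × neighboursIn G A (cur s) v ≡ true
  forward s = size>1⇒∈-other (prev s) (deg≥2 (cur∈A s))

  -- Opaque so that comparing u (2 + i) with u (suc (suc i)) never unfolds the walk.
  opaque
    step : Position → Position
    step s = let v , _ , cur-v = forward s in ⟨ cur s , v , proj₁ (∧-true⁻ cur-v) ⟩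

    position : ℕ → Position
    position zero    = ⟨ u₀ , u₀ , u₀∈A ⟩
    position (suc i) = step (position i)

    u : ℕ → Fin n
    u i = cur (position i)

    walk-adj : ∀ i → adj G (u i) (u (suc i)) ≡ true
    walk-adj i = proj₂ (∧-true⁻ (proj₂ (proj₂ (forward (position i)))))

    walk-non-backtracking : ∀ i → u (suc (suc i)) ≢ u i
    walk-non-backtracking i = proj₁ (proj₂ (forward (position (suc i))))

  RepeatAt : ℕ → Set
  RepeatAt j = ∃[ i ] i < j × u i ≡ u j

  repeatAt? : ∀ j → Dec (RepeatAt j)
  repeatAt? j = anyUpTo? (λ i → u i ≟ᶠ u j) j

  first-repeat : ∃[ j ] RepeatAt j × (∀ {b} → b < j → ¬ RepeatAt b)
  first-repeat with ¬∀⟶∃¬-smallest (suc n) (¬_ ∘ RepeatAt ∘ toℕ) (λ t → ¬? (repeatAt? (toℕ t))) some-repeat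
    where
    some-repeat : ¬ (∀ t → ¬ RepeatAt (toℕ {suc n} t))
    some-repeat none with pigeonhole (n<1+n n) (u ∘ toℕ)
    ... | a , b , a<b , uaub = none b (toℕ a , a<b , uaub)
  ... | t , ¬¬repeat , earlier = toℕ t , decidable-stable (repeatAt? (toℕ t)) ¬¬repeat , no-earlier
    where
    no-earlier : ∀ {b} → b < toℕ t → ¬ RepeatAt b
    no-earlier b<t = subst (¬_ ∘ RepeatAt) (trans (toℕ-inject (fromℕ< b<t)) (toℕ-fromℕ< b<t)) (earlier (fromℕ< b<t))

  injective-before : ∀ {j} → (∀ {b} → b < j → ¬ RepeatAt b) → ∀ {a b} → a < j → b < j → u a ≡ u b → a ≡ b
  injective-before none {a} {b} a<j b<j ua≡ub with <-cmp a b
  ... | tri< a<b _ _ = contradiction (a , a<b , ua≡ub) (none b<j)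
  ... | tri≈ _ a≡b _ = a≡b
  ... | tri> _ _ b<a = contradiction (b , b<a , sym ua≡ub) (none a<j)

  cycle : Cycle G
  cycle with first-repeat
  ... | j , (i , i<j , ui≡uj) , none = closing (j ∸ i) (m+[n∸m]≡n (<⇒≤ i<j))
    where
    closing : ∀ δ → i + δ ≡ j → Cycle G
    closing zero i+0≡j = contradiction (trans (sym (+-identityʳ i)) i+0≡j) (<⇒≢ i<j)
    closing (suc zero) i+1≡j =
      contradiction ui≡uj (adj⇒≢ G (subst (λ z → adj G (u i) (u z) ≡ true) (trans (+-comm 1 i) i+1≡j) (walk-adj i)))
    closing (suc (suc zero)) i+2≡j =
      contradiction (trans (cong u (trans (+-comm 2 i) i+2≡j)) (sym ui≡uj)) (walk-non-backtracking i)
    closing (suc (suc (suc δ))) i+δ≡j = record { j = δ ; f = f ; inj = inj ; step = step-adj ; close = close-adj }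
      where
      f : Fin (3 + δ) → Fin n
      f t = u (i + toℕ t)
      inj : ∀ {s t} → f s ≡ f t → s ≡ t
      inj {s} {t} fs≡ft = toℕ-injective (+-cancelˡ-≡ i _ _ (injective-before none (in-range s) (in-range t) fs≡ft))
        where
        in-range : ∀ t → i + toℕ t < j
        in-range t = subst (i + toℕ t <_) i+δ≡j (+-monoʳ-< i (toℕ<n t))
      step-adj : ∀ (t : Fin (2 + δ)) → adj G (f (inject₁ t)) (f (suc t)) ≡ true
      step-adj t rewrite toℕ-inject₁ t | +-suc i (toℕ t) = walk-adj (i + toℕ t)
      close-adj : adj G (f (fromℕ (2 + δ))) (f zero) ≡ true
      close-adj rewrite toℕ-fromℕ (2 + δ) | +-identityʳ i =
        subst (λ z → adj G (u (i + (2 + δ))) z ≡ true) (sym ui≡uj)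
          (subst (λ z → adj G (u (i + (2 + δ))) (u z) ≡ true) (trans (sym (+-suc i (2 + δ))) i+δ≡j) (walk-adj (i + (2 + δ))))

min-degree-2⇒cycle : ∀ {n} (G : Graph n) (A : VSet n) {u₀} → A u₀ ≡ true →
                     (∀ {u} → A u ≡ true → 2 ≤ degOn G A u) → Cycle G
min-degree-2⇒cycle G A u₀∈A deg≥2 = NonBacktrackingWalk.cycle G A deg≥2 u₀∈A

forest⇒empty⊎degree≤1 : ∀ {n} (G : Graph n) → IsForest G → ∀ (A : VSet n) →
                        (∀ v → A v ≡ false) ⊎ ∃[ u ] A u ≡ true × degOn G A u ≤ 1
forest⇒empty⊎degree≤1 G forest A with any? (λ u → (A u ≟ᵇ true) ×-dec (degOn G A u ≤? 1)) | any? (λ u → A u ≟ᵇ true)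
... | yes found | _              = inj₂ found
... | no  _     | no  empty      = inj₁ λ v → ¬-not λ Av → empty (v , Av)
... | no  none  | yes (u₀ , Au₀) =
  contradiction (min-degree-2⇒cycle G A Au₀ λ {u} Au → ≰⇒> λ deg≤1 → none (u , Au , deg≤1)) forest

module _ {n : ℕ} (G : Graph n) where

  induced : VSet n → Subgraph G
  induced X = record
    { verts  = Vec.tabulate X
    ; edges  = λ x y → X x ∧ neighboursIn G X x y
    ; esym   = edges-sym
    ; esub   = λ x y Xx∧Xy∧xy → proj₂ (∧-true⁻ {X y} (proj₂ (∧-true⁻ {X x} Xx∧Xy∧xy)))
    ; everts = λ x y Xx∧Xy∧xy → ∈-tabulate X (proj₁ (∧-true⁻ {X x} Xx∧Xy∧xy)) , ∈-tabulate X (proj₁ (∧-true⁻ {X y} (proj₂ (∧-true⁻ {X x} Xx∧Xy∧xy))))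
    }
    where
    edges-sym : ∀ x y → X x ∧ (X y ∧ adj G x y) ≡ X y ∧ (X x ∧ adj G y x)
    edges-sym x y with X x | X y
    ... | true  | true  = Graph.sym G x y
    ... | true  | false = refl
    ... | false | true  = refl
    ... | false | false = refl

  degH-induced : ∀ X {x} → X x ≡ true → degH (induced X) x ≡ degOn G X x
  degH-induced X {x} Xx rewrite Xx = count≡size (neighboursIn G X x)

  degH≤deg : ∀ (H : Subgraph G) v → degH H v ≤ deg G v
  degH≤deg H v rewrite count≡size (edges H v) | count≡size (adj G v) = size-mono {A = edges H v} {B = adj G v} (esub H v _)

  ζ-isolated : ∀ {v z} → IsZeta G v z → Isolated G v → z ≡ 0
  ζ-isolated {v} ((H , v∈H , _ , δ≤) , _) deg≡0 = n≤0⇒n≡0 (≤-trans (δ≤ v v∈H) (subst (degH H v ≤_) deg≡0 (degH≤deg H v)))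

  -- A subgraph of minimum degree 2 is a set of vertices with two neighbours inside it.
  ζ≤1 : IsForest G → ∀ {v z} → IsZeta G v z → z ≤ 1
  ζ≤1 forest {v} {z} ((H , v∈H , _ , δ≤) , _) with z ≤? 1
  ... | yes z≤1 = z≤1
  ... | no  z≰1 = contradiction (min-degree-2⇒cycle G V ([]=⇒lookup v∈H) λ {u} Vu → ≤-trans (≰⇒> z≰1) (deg≤ Vu)) forest
    where
    V = Vec.lookup (verts H)
    deg≤ : ∀ {u} → V u ≡ true → z ≤ degOn G V u
    deg≤ {u} Vu = ≤-trans (δ≤ u (lookup⇒[]= u _ Vu))
      (subst (_≤ degOn G V u) (sym (count≡size (edges H u)))
        (size-mono λ {x} ux → cong₂ _∧_ ([]=⇒lookup (proj₂ (Subgraph.everts H u x ux))) (esub H u x ux)))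

  ζ≥1 : ∀ {v z} → IsZeta G v z → ¬ Isolated G v → 1 ≤ z
  ζ≥1 {v} (_ , maximal) ¬isolated with size>0⇒∈ {A = adj G v} (subst (1 ≤_) (count≡size (adj G v)) (n≢0⇒n>0 ¬isolated))
  ... | w , vw = maximal (induced edge) 1 (∈-tabulate edge edge-v) δ≡1
    where
    edge : VSet n
    edge x = does (x ≟ᶠ v) ∨ does (x ≟ᶠ w)
    edge-v : edge v ≡ true
    edge-v rewrite dec-true (v ≟ᶠ v) refl = refl
    edge-w : edge w ≡ true
    edge-w rewrite dec-true (w ≟ᶠ w) refl = ∨-zeroʳ _
    edge⁻ : ∀ {x} → edge x ≡ true → x ≡ v ⊎ x ≡ w
    edge⁻ {x} ex with x ≟ᶠ v | x ≟ᶠ w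
    ... | yes x≡v | _       = inj₁ x≡v
    ... | no _    | yes x≡w = inj₂ x≡w
    ... | no _    | no _    = contradiction ex λ ()
    degOn-v : degOn G edge v ≡ 1
    degOn-v = size-singleton (cong₂ _∧_ edge-w vw) only-w
      where
      only-w : ∀ {x} → x ≢ w → edge x ∧ adj G v x ≡ false
      only-w {x} x≢w with x ≟ᶠ v
      ... | yes refl rewrite irrefl G x = ∧-zeroʳ (true ∨ does (x ≟ᶠ w))
      ... | no  x≢v  = cong (_∧ adj G v x) (dec-false (x ≟ᶠ w) x≢w)
    δ≡1 : IsMinDeg (induced edge) 1
    δ≡1 = (v , ∈-tabulate edge edge-v , trans (degH-induced edge edge-v) degOn-v) , δ≥1
      where
      δ≥1 : ∀ x → x ∈ₛ Vec.tabulate edge → 1 ≤ degH (induced edge) x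
      δ≥1 x x∈edge with edge⁻ {x} (∈-tabulate⁻ edge x∈edge)
      ... | inj₁ refl = ≤-reflexive (sym (trans (degH-induced edge edge-v) degOn-v))
      ... | inj₂ refl = subst (1 ≤_) (sym (degH-induced edge edge-w)) (size-∈ {A = neighboursIn G edge w} {v = v} (cong₂ _∧_ edge-v (trans (Graph.sym G w v) vw)))


  ζ-forest : IsForest G → ∀ {v z} → IsZeta G v z → z ≡ (if deg G v ≡ᵇ 0 then 0 else 1)
  ζ-forest forest {v} ζ-spec with deg G v in deg≡
  ... | zero  = ζ-isolated ζ-spec deg≡
  ... | suc _ = ≤-antisym (ζ≤1 forest ζ-spec) (ζ≥1 ζ-spec λ isolated → contradiction (trans (sym deg≡) isolated) λ ())

module Peeling {n : ℕ} (G : Graph n) (k : ℕ) where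

  K : ℕ
  K = suc (suc k)

  isolatedIn : VSet n → VSet n
  isolatedIn A v = A v ∧ (degOn G A v ≡ᵇ 0)

  isolatedIn⇒deg≡0 : ∀ {A : VSet n} {v} → isolatedIn A v ≡ true → degOn G A v ≡ 0
  isolatedIn⇒deg≡0 {A} {v} isoA = ≡ᵇ0⇒≡0 (degOn G A v) (proj₂ (∧-true⁻ {A v} isoA))

  isolatedIn-⊆ : ∀ {A B : VSet n} {v} → B ⊆ A → B v ≡ true → isolatedIn A v ≡ true → isolatedIn B v ≡ true
  isolatedIn-⊆ {A} {B} {v} B⊆A Bv isoA =
    cong₂ _∧_ Bv (cong (_≡ᵇ 0) (n≤0⇒n≡0 (subst (degOn G B v ≤_) (isolatedIn⇒deg≡0 isoA) (degOn-mono G B⊆A v))))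

  isolated-avoids-leaf : ∀ {A : VSet n} {u p v} → A u ≡ true → degOn G A u ≡ 1 → neighboursIn G A u p ≡ true →
                         isolatedIn A v ≡ true → v ≢ u × v ≢ p
  isolated-avoids-leaf {A} {u} {p} {v} Au u-leaf up isoA = v≢u , v≢p
    where
    v≢u : v ≢ u
    v≢u refl = contradiction (trans (sym u-leaf) (isolatedIn⇒deg≡0 isoA)) λ ()
    v≢p : v ≢ p
    v≢p refl = contradiction (isolatedIn⇒deg≡0 isoA)
      (>⇒≢ (size-∈ {A = neighboursIn G A v} (cong₂ _∧_ Au (trans (Graph.sym G v u) (proj₂ (∧-true⁻ {A v} up))))))

  WeightBounds : VSet n → (Fin n → ℕ) → Set
  WeightBounds A w = ∀ {v} → A v ≡ true → 1 ≤ w v × w v ≤ suc k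

  -- w v − 1 is the degree v must leave free in S for the leaves already merged into it, and
  -- every excluded vertex of A costs K units of weight not claimed by isolated vertices.
  record Solution (A : VSet n) (w : Fin n → ℕ) : Set where
    field
      S        : VSet n
      S⊆A      : S ⊆ A
      degree   : ∀ {v} → S v ≡ true → degOn G S v + w v ≤ suc k
      counting : K * size (A ∖ S) + ∑[ isolatedIn A ] w ≤ ∑[ A ] w

  extend-isolated : ∀ {A w u} → A u ≡ true → degOn G A u ≡ 0 → WeightBounds A w →
                    Solution (remove u A) w → Solution A w
  extend-isolated {A} {w} {u} Au u-isolated bounds sol = record
    { S = S ; S⊆A = S⊆A ; degree = degree ; counting = counting }
    where
    open Solution sol renaming (S to S′; S⊆A to S′⊆A′; degree to degree′; counting to counting′)
    A′ = remove u A
    S  = insert u S′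
    S⊆A : S ⊆ A
    S⊆A = insert-⊆ {S = S′} {A = A} Au S′⊆A′
    degree : ∀ {v} → S v ≡ true → degOn G S v + w v ≤ suc k
    degree {v} Sv with v ≟ᶠ u
    ... | yes refl = subst (λ d → d + w v ≤ suc k) (sym deg≡0) (proj₂ (bounds Au))
      where
      deg≡0 : degOn G S v ≡ 0
      deg≡0 = n≤0⇒n≡0 (subst (degOn G S v ≤_) u-isolated (degOn-mono G S⊆A v))
    ... | no  v≢u  = subst (λ d → d + w v ≤ suc k) (sym (degOn-insert-nonadj G vu)) (degree′ S′v)
      where
      S′v = trans (sym (insert-other S′ v≢u)) Sv
      vu  = trans (Graph.sym G v u) (isolated⇒nonadj G u-isolated (S⊆A Sv))
    isolated-weight : ∑[ isolatedIn A ] w ≤ ∑[ isolatedIn A′ ] w + w u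
    isolated-weight = begin
      ∑[ isolatedIn A ] w                   ≡⟨ ∑[]-remove-∈ w (cong₂ _∧_ Au (cong (_≡ᵇ 0) u-isolated)) ⟩
      ∑[ remove u (isolatedIn A) ] w + w u  ≤⟨ +-monoˡ-≤ (w u) (∑[]-mono-≤ {A = remove u (isolatedIn A)} still-isolated) ⟩
      ∑[ isolatedIn A′ ] w + w u            ∎
      where
      open ≤-Reasoning
      still-isolated : ∀ {v} → remove u (isolatedIn A) v ≡ true → isolatedIn A′ v ≡ true × w v ≤ w v
      still-isolated isoAv with remove-∈⁻ (isolatedIn A) isoAv
      ... | v≢u , isoA = isolatedIn-⊆ (remove-⊆ u A) (remove-∈ A v≢u (proj₁ (∧-true⁻ {A _} isoA))) isoA , ≤-refl
    counting : K * size (A ∖ S) + ∑[ isolatedIn A ] w ≤ ∑[ A ] w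
    counting = begin
      K * size (A ∖ S) + ∑[ isolatedIn A ] w               ≡⟨ cong (λ s → K * s + ∑[ isolatedIn A ] w) (∖-insert A S′ u) ⟩
      K * size (A′ ∖ S′) + ∑[ isolatedIn A ] w             ≤⟨ +-monoʳ-≤ (K * size (A′ ∖ S′)) isolated-weight ⟩
      K * size (A′ ∖ S′) + (∑[ isolatedIn A′ ] w + w u)    ≡⟨ +-assoc (K * size (A′ ∖ S′)) _ (w u) ⟨
      K * size (A′ ∖ S′) + ∑[ isolatedIn A′ ] w + w u      ≤⟨ +-monoˡ-≤ (w u) counting′ ⟩
      ∑[ A′ ] w + w u                                      ≡⟨ ∑[]-remove-∈ w Au ⟨
      ∑[ A ] w                                             ∎
      where open ≤-Reasoning

  extend-light-leaf : ∀ {A w u p} → A u ≡ true → degOn G A u ≡ 1 → neighboursIn G A u p ≡ true →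
                      w u + w p ≤ suc k → WeightBounds A w →
                      Solution (remove u A) (updateAt w p (_+ w u)) → Solution A w
  extend-light-leaf {A} {w} {u} {p} Au u-leaf up light bounds sol = record
    { S = S ; S⊆A = S⊆A ; degree = degree ; counting = counting }
    where
    open Solution sol renaming (S to S′; S⊆A to S′⊆A′; degree to degree′; counting to counting′)
    A′ = remove u A
    w′ = updateAt w p (_+ w u)
    S  = insert u S′
    S⊆A : S ⊆ A
    S⊆A = insert-⊆ {S = S′} {A = A} Au S′⊆A′
    Ap     = proj₁ (∧-true⁻ {A p} up)
    adj-up = proj₂ (∧-true⁻ {A p} up)
    p≢u : p ≢ u
    p≢u = adj⇒≢ G adj-up ∘ sym
    w′-other : ∀ {v} → v ≢ p → w′ v ≡ w v
    w′-other v≢p = updateAt-minimal _ p w v≢p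
    degree : ∀ {v} → S v ≡ true → degOn G S v + w v ≤ suc k
    degree {v} Sv with v ≟ᶠ u
    ... | yes refl = +-mono-≤ (subst (degOn G S v ≤_) u-leaf (degOn-mono G S⊆A v)) wu≤k
      where
      wu≤k : w u ≤ k
      wu≤k = ≤-pred (≤-trans (≤-trans (≤-reflexive (+-comm 1 (w u))) (+-monoʳ-≤ (w u) (proj₁ (bounds Ap)))) light)
    ... | no  v≢u  with v ≟ᶠ p
    ...   | yes refl = begin
      degOn G S v + w v          ≡⟨ cong (_+ w v) (degOn-insert-adj G (⊆-remove⇒∉ {S = S′} {A = A} S′⊆A′) (trans (Graph.sym G v u) adj-up)) ⟩
      suc (degOn G S′ v) + w v   ≡⟨ +-suc (degOn G S′ v) (w v) ⟨
      degOn G S′ v + suc (w v)   ≤⟨ +-monoʳ-≤ (degOn G S′ v) (subst (suc (w v) ≤_) (+-comm (w u) (w v)) (+-monoˡ-≤ (w v) (proj₁ (bounds Au)))) ⟩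
      degOn G S′ v + (w v + w u) ≡⟨ cong (degOn G S′ v +_) (updateAt-updates v w) ⟨
      degOn G S′ v + w′ v        ≤⟨ degree′ S′v ⟩
      suc k                      ∎
      where
      open ≤-Reasoning
      S′v = trans (sym (insert-other S′ v≢u)) Sv
    ...   | no  v≢p  = subst₂ (λ d x → d + x ≤ suc k) (sym (degOn-insert-nonadj G vu)) (w′-other v≢p) (degree′ S′v)
      where
      S′v = trans (sym (insert-other S′ v≢u)) Sv
      vu  = trans (Graph.sym G v u) (leaf⇒nonadj G u-leaf up (S⊆A Sv) v≢p)
    isolated-weight : ∑[ isolatedIn A ] w ≤ ∑[ isolatedIn A′ ] w′
    isolated-weight = ∑[]-mono-≤ {A = isolatedIn A} still-isolated
      where
      still-isolated : ∀ {v} → isolatedIn A v ≡ true → isolatedIn A′ v ≡ true × w v ≤ w′ v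
      still-isolated {v} isoA with isolated-avoids-leaf Au u-leaf up isoA
      ... | v≢u , v≢p = isolatedIn-⊆ (remove-⊆ u A) (remove-∈ A v≢u (proj₁ (∧-true⁻ {A v} isoA))) isoA , ≤-reflexive (sym (w′-other v≢p))
    total-weight : ∑[ A′ ] w′ ≡ ∑[ A ] w
    total-weight = +-cancelʳ-≡ (w p) _ _ (begin
      ∑[ A′ ] w′ + w p          ≡⟨ ∑[]-updateAt w (_+ w u) (remove-∈ A p≢u Ap) ⟩
      ∑[ A′ ] w + (w p + w u)   ≡⟨ cong (∑[ A′ ] w +_) (+-comm (w p) (w u)) ⟩
      ∑[ A′ ] w + (w u + w p)   ≡⟨ +-assoc (∑[ A′ ] w) (w u) (w p) ⟨
      ∑[ A′ ] w + w u + w p     ≡⟨ cong (_+ w p) (∑[]-remove-∈ w Au) ⟨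
      ∑[ A ] w + w p            ∎)
      where open ≡-Reasoning
    counting : K * size (A ∖ S) + ∑[ isolatedIn A ] w ≤ ∑[ A ] w
    counting = begin
      K * size (A ∖ S) + ∑[ isolatedIn A ] w     ≡⟨ cong (λ s → K * s + ∑[ isolatedIn A ] w) (∖-insert A S′ u) ⟩
      K * size (A′ ∖ S′) + ∑[ isolatedIn A ] w   ≤⟨ +-monoʳ-≤ (K * size (A′ ∖ S′)) isolated-weight ⟩
      K * size (A′ ∖ S′) + ∑[ isolatedIn A′ ] w′ ≤⟨ counting′ ⟩
      ∑[ A′ ] w′                                 ≡⟨ total-weight ⟩
      ∑[ A ] w                                   ∎
      where open ≤-Reasoning

  extend-heavy-leaf : ∀ {A w u p} → A u ≡ true → degOn G A u ≡ 1 → neighboursIn G A u p ≡ true →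
                      suc k < w u + w p → WeightBounds A w →
                      Solution (remove p (remove u A)) w → Solution A w
  extend-heavy-leaf {A} {w} {u} {p} Au u-leaf up heavy bounds sol = record
    { S = S ; S⊆A = S⊆A ; degree = degree ; counting = counting }
    where
    open Solution sol renaming (S to S′; S⊆A to S′⊆A″; degree to degree′; counting to counting′)
    A′ = remove u A
    A″ = remove p A′
    S  = insert u S′
    S⊆A : S ⊆ A
    S⊆A = insert-⊆ {S = S′} {A = A} Au (remove-⊆ p A′ ∘ S′⊆A″)
    Ap  = proj₁ (∧-true⁻ {A p} up)
    p≢u : p ≢ u
    p≢u = adj⇒≢ G (proj₂ (∧-true⁻ {A p} up)) ∘ sym
    A′p = remove-∈ A p≢u Ap
    S′p : S′ p ≡ false
    S′p = ⊆-remove⇒∉ {S = S′} {A = A′} S′⊆A″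
    degree : ∀ {v} → S v ≡ true → degOn G S v + w v ≤ suc k
    degree {v} Sv with v ≟ᶠ u
    ... | yes refl = subst (λ d → d + w v ≤ suc k) (sym (∑[]-empty (const 1) no-neighbour)) (proj₂ (bounds Au))
      where
      no-neighbour : ∀ y → S y ∧ adj G v y ≡ false
      no-neighbour y with y ≟ᶠ p | S y in Sy
      ... | _        | false = refl
      ... | yes refl | true  = contradiction (trans (sym Sy) (trans (insert-other S′ p≢u) S′p)) λ ()
      ... | no  y≢p  | true  = leaf⇒nonadj G u-leaf up (S⊆A Sy) y≢p
    ... | no  v≢u  = subst (λ d → d + w v ≤ suc k) (sym (degOn-insert-nonadj G vu)) (degree′ S′v)
      where
      S′v = trans (sym (insert-other S′ v≢u)) Sv
      vu  = trans (Graph.sym G v u) (leaf⇒nonadj G u-leaf up (S⊆A Sv) (proj₁ (remove-∈⁻ A′ (S′⊆A″ S′v))))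
    excluded : size (A ∖ S) ≡ suc (size (A″ ∖ S′))
    excluded = begin
      size (A ∖ S)                   ≡⟨ ∖-insert A S′ u ⟩
      size (A′ ∖ S′)                 ≡⟨ size-remove-∈ {A = A′ ∖ S′} (cong₂ _∧_ A′p (cong not S′p)) ⟩
      suc (size (remove p (A′ ∖ S′))) ≡⟨ cong suc (size-cong (remove-∖ A′ S′ p)) ⟩
      suc (size (A″ ∖ S′))           ∎
      where open ≡-Reasoning
    isolated-weight : ∑[ isolatedIn A ] w ≤ ∑[ isolatedIn A″ ] w
    isolated-weight = ∑[]-mono-≤ {A = isolatedIn A} still-isolated
      where
      still-isolated : ∀ {v} → isolatedIn A v ≡ true → isolatedIn A″ v ≡ true × w v ≤ w v
      still-isolated {v} isoA with isolated-avoids-leaf Au u-leaf up isoA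
      ... | v≢u , v≢p = isolatedIn-⊆ (remove-⊆ u A ∘ remove-⊆ p A′) A″v isoA , ≤-refl
        where A″v = remove-∈ A′ v≢p (remove-∈ A v≢u (proj₁ (∧-true⁻ {A v} isoA)))
    counting : K * size (A ∖ S) + ∑[ isolatedIn A ] w ≤ ∑[ A ] w
    counting = begin
      K * size (A ∖ S) + ∑[ isolatedIn A ] w           ≡⟨ cong (λ s → K * s + ∑[ isolatedIn A ] w) excluded ⟩
      K * suc (size (A″ ∖ S′)) + ∑[ isolatedIn A ] w   ≤⟨ +-monoʳ-≤ (K * suc (size (A″ ∖ S′))) isolated-weight ⟩
      K * suc (size (A″ ∖ S′)) + ∑[ isolatedIn A″ ] w  ≡⟨ pull-out-K K (size (A″ ∖ S′)) (∑[ isolatedIn A″ ] w) ⟩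
      K * size (A″ ∖ S′) + ∑[ isolatedIn A″ ] w + K    ≤⟨ +-mono-≤ counting′ (subst (K ≤_) (+-comm (w u) (w p)) heavy) ⟩
      ∑[ A″ ] w + (w p + w u)                          ≡⟨ +-assoc (∑[ A″ ] w) (w p) (w u) ⟨
      ∑[ A″ ] w + w p + w u                            ≡⟨ cong (_+ w u) (∑[]-remove-∈ w A′p) ⟨
      ∑[ A′ ] w + w u                                  ≡⟨ ∑[]-remove-∈ w Au ⟨
      ∑[ A ] w                                         ∎
      where
      open ≤-Reasoning
      pull-out-K : ∀ a b c → a * suc b + c ≡ a * b + c + a
      pull-out-K = solve-∀

  empty-solution : ∀ {A w} → (∀ v → A v ≡ false) → Solution A w
  empty-solution {A} {w} A≡∅ = record
    { S = const false ; S⊆A = λ () ; degree = λ () ; counting = ≤-trans (≤-reflexive nothing-counted) z≤n }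
    where
    nothing-counted : K * size (A ∖ const false) + ∑[ isolatedIn A ] w ≡ 0
    nothing-counted
      rewrite ∑[]-empty {A = A ∖ const false} (const 1) (λ v → cong (_∧ true) (A≡∅ v))
            | ∑[]-empty {A = isolatedIn A} w (λ v → cong (_∧ (degOn G A v ≡ᵇ 0)) (A≡∅ v))
            | *-zeroʳ K = refl

  merge-bounds : ∀ {A w u p} → A u ≡ true → p ≢ u → w u + w p ≤ suc k → WeightBounds A w →
                 WeightBounds (remove u A) (updateAt w p (_+ w u))
  merge-bounds {A} {w} {u} {p} Au p≢u light bounds {v} A′v with v ≟ᶠ p | remove-∈⁻ A A′v
  ... | yes refl | _ , Av = subst (λ x → 1 ≤ x × x ≤ suc k) (sym (updateAt-updates p w))
    (≤-trans (proj₁ (bounds Av)) (m≤m+n (w p) (w u)) , subst (_≤ suc k) (+-comm (w u) (w p)) light)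
  ... | no  v≢p  | _ , Av = subst (λ x → 1 ≤ x × x ≤ suc k) (sym (updateAt-minimal v p w v≢p)) (bounds Av)

  solve : IsForest G → ∀ N {A w} → size A ≤ N → WeightBounds A w → Solution A w
  solve forest zero    size≤0 bounds = empty-solution (size≡0⇒∉ (n≤0⇒n≡0 size≤0))
  solve forest (suc N) {A} {w} size≤N bounds with forest⇒empty⊎degree≤1 G forest A
  ... | inj₁ A-empty = empty-solution A-empty
  ... | inj₂ (u , Au , deg≤1) with degOn G A u in deg≡ | deg≤1
  ...   | 0 | _ = extend-isolated Au deg≡ bounds (solve forest N A′≤N λ A′v → bounds (remove-⊆ u A A′v))
    where A′≤N = size-remove-∈-≤ {A = A} Au size≤N
  ...   | suc (suc _) | s≤s ()
  ...   | 1 | _ with size>0⇒∈ {A = neighboursIn G A u} (≤-reflexive (sym deg≡))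
  ...     | p , up with w u + w p ≤? suc k
  ...       | yes light = extend-light-leaf Au deg≡ up light bounds (solve forest N A′≤N (merge-bounds Au p≢u light bounds))
    where
    A′≤N = size-remove-∈-≤ {A = A} Au size≤N
    p≢u  = adj⇒≢ G (proj₂ (∧-true⁻ {A p} up)) ∘ sym
  ...       | no  heavy = extend-heavy-leaf Au deg≡ up (≰⇒> heavy) bounds (solve forest N A″≤N λ A″v → bounds (A″⊆A A″v))
    where
    A″⊆A : remove p (remove u A) ⊆ A
    A″⊆A = remove-⊆ u A ∘ remove-⊆ p (remove u A)
    A″≤N = ≤-trans (size-mono {A = remove p (remove u A)} (remove-⊆ p (remove u A))) (size-remove-∈-≤ {A = A} Au size≤N)

forest⇒large-k-independent-set : ∀ {n} (G : Graph n) → IsForest G → ∀ k →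
  ∃[ S ] (∀ {v} → S v ≡ true → degOn G S v ≤ k) × suc k * n + numIsolated G ≤ suc (suc k) * size S
forest⇒large-k-independent-set {n} G forest k = S , (λ Sv → ≤-pred (subst (_≤ suc k) (+-comm _ 1) (degree Sv))) , large
  where
  open Peeling G k
  open Solution (solve forest n (size≤n (const true)) λ _ → ≤-refl , s≤s z≤n)
  a = size S
  b = size (const true ∖ S)
  isolated-count : ∑[ isolatedIn (const true) ] const 1 ≡ numIsolated G
  isolated-count = trans (size-cong λ v → cong (_≡ᵇ 0) (sym (count≡size (adj G v)))) (sym (count≡size (λ v → deg G v ≡ᵇ 0)))
  excluded : K * b + numIsolated G ≤ n
  excluded = subst₂ (λ m t → K * b + m ≤ t) isolated-count size-full counting
  large : suc k * n + numIsolated G ≤ K * a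
  large = +-cancelʳ-≤ (K * b) _ _ (begin
    suc k * n + numIsolated G + K * b  ≡⟨ +-assoc (suc k * n) _ _ ⟩
    suc k * n + (numIsolated G + K * b) ≡⟨ cong (suc k * n +_) (+-comm (numIsolated G) (K * b)) ⟩
    suc k * n + (K * b + numIsolated G) ≤⟨ +-monoʳ-≤ (suc k * n) excluded ⟩
    suc k * n + n                       ≡⟨ +-comm (suc k * n) n ⟩
    K * n                               ≡⟨ cong (K *_) (trans (sym (size-full {n = n})) (sym (size-∖-+ {A = const true} {S = S} (const refl)))) ⟩
    K * (b + a)                         ≡⟨ *-distribˡ-+ K b a ⟩
    K * b + K * a                       ≡⟨ +-comm (K * b) (K * a) ⟩
    K * a + K * b                       ∎)
    where open ≤-Reasoning

tabulate∈subsets : ∀ {n} (S : VSet n) → Vec.tabulate S ∈ subsets n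
tabulate∈subsets {zero}  S = here refl
tabulate∈subsets {suc n} S with S zero
... | true  = ∈-++⁺ˡ (∈-map⁺ (true ∷_) (tabulate∈subsets (S ∘ suc)))
... | false = ∈-++⁺ʳ (map (true ∷_) (subsets n)) (∈-map⁺ (false ∷_) (tabulate∈subsets (S ∘ suc)))

∣tabulate∣≡size : ∀ {n} (S : VSet n) → ∣ Vec.tabulate S ∣ ≡ size S
∣tabulate∣≡size {zero}  S = refl
∣tabulate∣≡size {suc n} S with S zero
... | true  = cong suc (∣tabulate∣≡size (S ∘ suc))
... | false = ∣tabulate∣≡size (S ∘ suc)

∈⇒≤foldr-⊔ : ∀ {x} {xs : List ℕ} → x ∈ xs → x ≤ foldr _⊔_ 0 xs
∈⇒≤foldr-⊔ {xs = y ∷ xs} (here refl) = m≤m⊔n y _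
∈⇒≤foldr-⊔ {xs = y ∷ xs} (there x∈xs) = ≤-trans (∈⇒≤foldr-⊔ x∈xs) (m≤n⊔m y _)

foldr-∧-true : ∀ {A : Set} (h : A → Bool) (xs : List A) → (∀ x → h x ≡ true) → foldr (λ x b → h x ∧ b) true xs ≡ true
foldr-∧-true h []       all-true = refl
foldr-∧-true h (x ∷ xs) all-true rewrite all-true x = foldr-∧-true h xs all-true

module _ {n : ℕ} (k : ℕ) (G : Graph n) (S : VSet n) (S-k-independent : ∀ {v} → S v ≡ true → degOn G S v ≤ k) where

  degIn-tabulate : ∀ v → degIn G (Vec.tabulate S) v ≡ degOn G S v
  degIn-tabulate v = trans (count≡size (λ u → Vec.lookup (Vec.tabulate S) u ∧ adj G v u)) (size-cong λ u → cong (_∧ adj G v u) (lookup∘tabulate S u))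

  kIndepᵇ-tabulate : kIndepᵇ k G (Vec.tabulate S) ≡ true
  kIndepᵇ-tabulate = foldr-∧-true _ (allFin n) member-ok
    where
    member-ok : ∀ v → not (Vec.lookup (Vec.tabulate S) v) ∨ (degIn G (Vec.tabulate S) v ≤ᵇ k) ≡ true
    member-ok v rewrite lookup∘tabulate S v with S v in Sv
    ... | false = refl
    ... | true  = Equivalence.to T-≡ (≤⇒≤ᵇ (subst (_≤ k) (sym (degIn-tabulate v)) (S-k-independent Sv)))

  k-independent⇒≤α : size S ≤ α k G
  k-independent⇒≤α = subst (_≤ α k G) (∣tabulate∣≡size S)
    (∈⇒≤foldr-⊔ (∈-map⁺ ∣_∣ (∈-filter⁺ (T? ∘ kIndepᵇ k G) (tabulate∈subsets S) (Equivalence.from T-≡ kIndepᵇ-tabulate))))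

infix 8 _/1+_
_/1+_ : ℕ → ℕ → ℚᵘ
a /1+ d = mkℚᵘ (ℤ.+ a) d

/1+-≃ : ∀ {a b c d} → a * suc d ≡ c * suc b → a /1+ b ≃ c /1+ d
/1+-≃ {a} {b} {c} {d} eq = *≡* (trans (sym (pos-* a (suc d))) (trans (cong ℤ.+_ eq) (pos-* c (suc b))))

/1+-≤ : ∀ {a b c d} → a * suc d ≤ c * suc b → a /1+ b ≤ᵘ c /1+ d
/1+-≤ {a} {b} {c} {d} le = *≤* (subst₂ ℤ._≤_ (pos-* a (suc d)) (pos-* c (suc b)) (ℤ.+≤+ le))

/1+-+ : ∀ a b c d → a /1+ b +ᵘ c /1+ d ≃ (a * suc d + c * suc b) /1+ (d + b * suc d)
/1+-+ a b c d = ≃-reflexive (cong (λ i → mkℚᵘ i (d + b * suc d))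
  (trans (cong₂ ℤ._+_ (sym (pos-* a (suc d))) (sym (pos-* c (suc b)))) (sym (pos-+ (a * suc d) (c * suc b)))))

/1+-+-same : ∀ a b d → a /1+ d +ᵘ b /1+ d ≃ (a + b) /1+ d
/1+-+-same a b d = ≃-trans (/1+-+ a d b d) (/1+-≃ (common-denominator a b d))
  where
  common-denominator : ∀ a b d → (a * suc d + b * suc d) * suc d ≡ (a + b) * suc (d + d * suc d)
  common-denominator = solve-∀

1/ᵘ-/1+ : ∀ p c d .{{_ : ℚᵘ.NonZero p}} → p ≃ suc c /1+ d → ℚᵘ.1/ p ≃ suc d /1+ c
1/ᵘ-/1+ (mkℚᵘ +[1+ a ] b) c d (*≡* eq) =
  *≡* (trans (ℤ.*-comm +[1+ b ] +[1+ c ]) (trans (sym eq) (ℤ.*-comm +[1+ a ] +[1+ d ])))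

toℚᵘ-ℕtoℚ : ∀ z → toℚᵘ (ℕtoℚ z) ≃ z /1+ 0
toℚᵘ-ℕtoℚ z = toℚᵘ-fromℚᵘ (z /1+ 0)

toℚᵘ-sumℚ : ∀ {n} (f : Fin n → ℚ) (g : Fin n → ℕ) d → (∀ v → toℚᵘ (f v) ≃ g v /1+ d) → toℚᵘ (sumℚ f) ≃ ∑ g /1+ d
toℚᵘ-sumℚ f g d f≃g = go f id g f≃g
  where
  go : ∀ {X : Set} {n} (f : X → ℚ) (σ : Fin n → X) (g : Fin n → ℕ) → (∀ v → toℚᵘ (f (σ v)) ≃ g v /1+ d) →
       toℚᵘ (foldr (λ x acc → f x ℚ.+ acc) ℚ.0ℚ (tabulate σ)) ≃ ∑ g /1+ d
  go {n = zero}  f σ g f≃g = /1+-≃ refl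
  go {n = suc n} f σ g f≃g = begin
    toℚᵘ (f (σ zero) ℚ.+ _)                  ≈⟨ toℚᵘ-homo-+ (f (σ zero)) _ ⟩
    toℚᵘ (f (σ zero)) +ᵘ toℚᵘ _               ≈⟨ ℚᵘP.+-cong (f≃g zero) (go f (σ ∘ suc) (g ∘ suc) (f≃g ∘ suc)) ⟩
    g zero /1+ d +ᵘ ∑ (g ∘ suc) /1+ d         ≈⟨ /1+-+-same (g zero) (∑ (g ∘ suc)) d ⟩
    (g zero + ∑ (g ∘ suc)) /1+ d              ∎
    where open ≃-Reasoning

module _ (k : ℕ) where

  toℚᵘ-reciprocal : ∀ z → toℚᵘ ((ℚ.1/ (ℕtoℚ z ℚ.+ (ℤ.+ 1 ℚ./ suc k))) {{zeta+1/r-nonZero z (suc k)}}) ≃ suc k /1+ (z * suc k)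
  toℚᵘ-reciprocal z = begin
    toℚᵘ ((ℚ.1/ x) {{x≢0}})       ≈⟨ toℚᵘ-homo-1/ x {{x≢0}} ⟩
    (ℚᵘ.1/ toℚᵘ x) {{_}}          ≈⟨ 1/ᵘ-/1+ (toℚᵘ x) (z * suc k) k {{_}} toℚᵘ-x ⟩
    suc k /1+ (z * suc k)         ∎
    where
    open ≃-Reasoning
    x = ℕtoℚ z ℚ.+ (ℤ.+ 1 ℚ./ suc k)
    x≢0 = zeta+1/r-nonZero z (suc k)
    toℚᵘ-x : toℚᵘ x ≃ suc (z * suc k) /1+ k
    toℚᵘ-x = begin
      toℚᵘ x                                     ≈⟨ toℚᵘ-homo-+ (ℕtoℚ z) (ℤ.+ 1 ℚ./ suc k) ⟩
      toℚᵘ (ℕtoℚ z) +ᵘ toℚᵘ (ℤ.+ 1 ℚ./ suc k)      ≈⟨ ℚᵘP.+-cong (toℚᵘ-ℕtoℚ z) (toℚᵘ-fromℚᵘ (1 /1+ k)) ⟩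
      z /1+ 0 +ᵘ 1 /1+ k                         ≈⟨ /1+-+ z 0 1 k ⟩
      (z * suc k + 1 * 1) /1+ (k + 0 * suc k)    ≈⟨ /1+-≃ (same-value z k) ⟩
      suc (z * suc k) /1+ k                      ∎
      where
      same-value : ∀ z k → (z * suc k + 1 * 1) * suc k ≡ suc (z * suc k) * suc (k + 0 * suc k)
      same-value = solve-∀

  toℚᵘ-term-0 : toℚᵘ (term (suc k) 0) ≃ 1 /1+ 0
  toℚᵘ-term-0 = ≃-reflexive (cong toℚᵘ (ℚP.p≤q⇒p⊓q≡p 1≤reciprocal))
    where
    1≤reciprocal = toℚᵘ-cancel-≤ (ℚᵘP.≤-respʳ-≃ (ℚᵘP.≃-sym (toℚᵘ-reciprocal 0)) (/1+-≤ (s≤s z≤n)))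

  toℚᵘ-term-suc : ∀ z → toℚᵘ (term (suc k) (suc z)) ≃ suc k /1+ (suc z * suc k)
  toℚᵘ-term-suc z = ≃-trans (≃-reflexive (cong toℚᵘ (ℚP.p≥q⇒p⊓q≡q reciprocal≤1))) (toℚᵘ-reciprocal (suc z))
    where
    reciprocal≤1 = toℚᵘ-cancel-≤ (ℚᵘP.≤-respˡ-≃ (ℚᵘP.≃-sym (toℚᵘ-reciprocal (suc z))) (/1+-≤ (numerator≤ z k)))
      where
      numerator≤ : ∀ z k → suc k * 1 ≤ 1 * suc (suc z * suc k)
      numerator≤ z k = ≤-trans (≤-reflexive (*-identityʳ (suc k))) (≤-trans (m≤m+n (suc k) (z * suc k)) (≤-trans (n≤1+n _) (≤-reflexive (sym (*-identityˡ _)))))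

  toℚᵘ-term-forest : ∀ isolated → toℚᵘ (term (suc k) (if isolated then 0 else 1)) ≃ (suc k + (if isolated then 1 else 0)) /1+ suc k
  toℚᵘ-term-forest true  = ≃-trans (toℚᵘ-term-0) (/1+-≃ (isolated-share k))
    where
    isolated-share : ∀ k → 1 * suc (suc k) ≡ (suc k + 1) * 1
    isolated-share = solve-∀
  toℚᵘ-term-forest false = ≃-trans (toℚᵘ-term-suc 0) (/1+-≃ (edge-share k))
    where
    edge-share : ∀ k → suc k * suc (suc k) ≡ (suc k + 0) * suc (1 * suc k)
    edge-share = solve-∀

  toℚᵘ-mixed : ∀ n m → m ≤ n →
    toℚᵘ ((ℤ.+ ((n ∸ m) * suc k)) ℚ./ suc (suc k) ℚ.+ ℕtoℚ m) ≃ (n * suc k + m) /1+ suc k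
  toℚᵘ-mixed n m m≤n = begin
    toℚᵘ ((ℤ.+ ((n ∸ m) * suc k)) ℚ./ suc (suc k) ℚ.+ ℕtoℚ m)        ≈⟨ toℚᵘ-homo-+ ((ℤ.+ ((n ∸ m) * suc k)) ℚ./ suc (suc k)) (ℕtoℚ m) ⟩
    toℚᵘ ((ℤ.+ ((n ∸ m) * suc k)) ℚ./ suc (suc k)) +ᵘ toℚᵘ (ℕtoℚ m)  ≈⟨ ℚᵘP.+-cong (toℚᵘ-fromℚᵘ (((n ∸ m) * suc k) /1+ suc k)) (toℚᵘ-ℕtoℚ m) ⟩
    ((n ∸ m) * suc k) /1+ suc k +ᵘ m /1+ 0                          ≈⟨ /1+-+ ((n ∸ m) * suc k) (suc k) m 0 ⟩
    ((n ∸ m) * suc k * 1 + m * suc (suc k)) /1+ (0 + suc k * 1)     ≈⟨ /1+-≃ same-value ⟩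
    (n * suc k + m) /1+ suc k                                       ∎
    where
    open ≃-Reasoning
    regroup : ∀ d m k → (d * suc k * 1 + m * suc (suc k)) * suc (suc k) ≡ ((d + m) * suc k + m) * suc (0 + suc k * 1)
    regroup = solve-∀
    same-value : ((n ∸ m) * suc k * 1 + m * suc (suc k)) * suc (suc k) ≡ (n * suc k + m) * suc (0 + suc k * 1)
    same-value = trans (regroup (n ∸ m) m k) (cong (λ x → (x * suc k + m) * suc (0 + suc k * 1)) (m∸n+n≡m m≤n))

module _ {n : ℕ} (k : ℕ) (G : Graph n) (forest : IsForest G)
         (ζ : Fin n → ℕ) (ζ-spec : ∀ v → IsZeta G v (ζ v)) where

  Z-forest : toℚᵘ (Z (suc k) ζ) ≃ (n * suc k + numIsolated G) /1+ suc k
  Z-forest = ≃-trans (toℚᵘ-sumℚ (term (suc k) ∘ ζ) share (suc k) term-share) (/1+-≃ (cong (_* suc (suc k)) ∑-share))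
    where
    share : Fin n → ℕ
    share v = suc k + (if deg G v ≡ᵇ 0 then 1 else 0)
    term-share : ∀ v → toℚᵘ (term (suc k) (ζ v)) ≃ share v /1+ suc k
    term-share v = subst (λ z → toℚᵘ (term (suc k) z) ≃ share v /1+ suc k) (sym (ζ-forest G forest (ζ-spec v)))
                     (toℚᵘ-term-forest k (deg G v ≡ᵇ 0))
    ∑-share : ∑ share ≡ n * suc k + numIsolated G
    ∑-share = begin
      ∑ share                                                    ≡⟨ ∑-distrib-+ (const (suc k)) (λ v → if deg G v ≡ᵇ 0 then 1 else 0) ⟩
      ∑ {n} (const (suc k)) + size (λ v → deg G v ≡ᵇ 0)         ≡⟨ cong₂ _+_ (∑-const n (suc k)) (sym (count≡size (λ v → deg G v ≡ᵇ 0))) ⟩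
      n * suc k + numIsolated G                                  ∎
      where open ≡-Reasoning

  Z≤α : Z (suc k) ζ ℚ.≤ ℕtoℚ (α k G)
  Z≤α = toℚᵘ-cancel-≤ (ℚᵘP.≤-respˡ-≃ (ℚᵘP.≃-sym Z-forest) (ℚᵘP.≤-respʳ-≃ (ℚᵘP.≃-sym (toℚᵘ-ℕtoℚ (α k G))) (/1+-≤ bound)))
    where
    bound : (n * suc k + numIsolated G) * 1 ≤ α k G * suc (suc k)
    bound with forest⇒large-k-independent-set G forest k
    ... | S , S-k-independent , large = begin
      (n * suc k + numIsolated G) * 1 ≡⟨ *-identityʳ _ ⟩
      n * suc k + numIsolated G       ≡⟨ cong (_+ numIsolated G) (*-comm n (suc k)) ⟩
      suc k * n + numIsolated G       ≤⟨ large ⟩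
      suc (suc k) * size S            ≤⟨ *-monoʳ-≤ (suc (suc k)) (k-independent⇒≤α k G S S-k-independent) ⟩
      suc (suc k) * α k G             ≡⟨ *-comm (suc (suc k)) (α k G) ⟩
      α k G * suc (suc k)             ∎
      where open ≤-Reasoning

  Z≡ : Z (suc k) ζ ≡ (ℤ.+ ((n ∸ numIsolated G) * suc k)) ℚ./ suc (suc k) ℚ.+ ℕtoℚ (numIsolated G)
  Z≡ = toℚᵘ-injective (≃-trans Z-forest (ℚᵘP.≃-sym (toℚᵘ-mixed k n (numIsolated G) numIsolated≤n)))
    where
    numIsolated≤n : numIsolated G ≤ n
    numIsolated≤n = subst (_≤ n) (sym (count≡size (λ v → deg G v ≡ᵇ 0))) (size≤n (λ v → deg G v ≡ᵇ 0))

theorem8 : (k : ℕ) → .{{_ : NonZero k}} →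
           (n : ℕ) (G : Graph n) → IsForest G →
           (m : ℕ) → m ≡ numIsolated G →
           (ζ : Fin n → ℕ) → (∀ v → IsZeta G v (ζ v)) →
           (Z (suc k) ζ ℚ.≤ ℕtoℚ (α k G))
           × (Z (suc k) ζ ≡ ((ℤ.+ ((n ∸ m) * suc k)) ℚ./ suc (suc k)) ℚ.+ ℕtoℚ m)
theorem8 k n G forest m refl ζ ζ-spec = Z≤α k G forest ζ ζ-spec , Z≡ k G forest ζ ζ-spec
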